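{- Let $T$ be an admissible triangle of order $n$ and $1\le d\le n-1$. (a) If row $d$ of $T$ is an $\mathcal{X}$-row and row $d-1$ is a $\mathcal{V}$-row (so that $R_d(T)$ is defined), then $L_d(R_d(T))=T$. (b) If row $d$ of $T$ is a $\mathcal{V}$-row and row $d-1$ is an $\mathcal{X}$-row (so that $L_d(T)$ is defined), then $R_d(L_d(T))=T$.
   Context: Let $\mathcal{X}=\{x_i,y_i:1\le i\le n\}$ be formal symbols. For $1\le k\le n-1$, let $\mathcal{V}_k=\{a_{ij},b_{ij}:1\le i<j\le n,\ j-i=k\}$ be formal symbols. A triangle of order $n$ is an array with rows $1,\dots,n$, where row $r$ has $r$ entries at positions $1,\dots,r$. Row $n$ is $1,2,\dots,n$, and the entries of rows $1,\dots,n-1$ lie in $\mathcal{X}\cup\mathcal{V}_1\cup\dots\cup\mathcal{V}_{n-1}$. There is also a notional empty row $0$. A row $r\in\{1,\dots,n-1\}$ is an $\mathcal{X}$-row if all its entries lie in $\mathcal{X}$, and a $\mathcal{V}$-row if all its entries lie in a single $\mathcal{V}_k$; row $0$ counts as both. An arrangement is a triple $(u,v,w)$ such that, for some $2\le e\le n$ and $1\le p\le e-1$, $u$ and $w$ are the entries at positions $p$ and $p+1$ of row $e$ and $v$ is the entry at position $p$ of row $e-1$. An admissible ranking assigns a nonnegative integer rank to each row $0,\dots,n$ such that: - row $n$ has rank $0$ and row $n-1$ has rank $1$; - for each $1\le r\le n-1$, if row $r$ has rank $k$ then either row $r$ is an $\mathcal{X}$-row and row $r-1$ has rank $k$, or all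 entries of row $r$ lie in $\mathcal{V}_k$ and row $r-1$ has rank $k+1$. Such a ranking is unique if it exists; a triangle with one is called ranked. In a ranked triangle, an entry $u$ in a row of rank $t$ has a left value $l(u)$ and a right value $r(u)$: - for $u=a_{ij}$ or $b_{ij}$: $l=i$, $r=j$; - for $u=x_i$: $l=i$, $r=i+t$; - for $u=y_j$: $l=j-t$, $r=j$; - for the integer $u=i$ in row $n$: $l=r=i$. The triangle has the monotone diagonal property if every arrangement $(u,v,w)$ satisfies $l(u)\le l(v)$ and $r(v)\le r(w)$, together with $l(u)<l(v)$ whenever $u$ is some $y_j$ and $r(v)<r(w)$ whenever $w$ is some $x_j$. It has the monotone row property if every arrangement satisfies $l(u)<l(w)$. A triangle is admissible if it is ranked and has both properties. Raising $R_d$: defined when row $d$ is an $\mathcal{X}$-row and row $d-1$ is a $\mathcal{V}$-row, both of rank $t$. All other rows are unchanged. 1. Wherever row $d-1$ has $b_{jk}$ at position $p$ and row $d$ has $x_j$ at position $p$, exchange them. Wherever row $d-1$ has $a_{jk}$ at position $p$ and row $d$ has $y_k$ at position $p+1$, move $y_k$ to position $p$ of row $d-1$ and $a_{jk}$ to position $p+1$ of row $d$. 2. Replace each remaining $a_{jk}$ in row $d-1$ by $x_j$ and each remaining $b_{jk}$ there by $y_k$. Replace each remaining $x_i$ in row $d$ by $a_{i,i+t}$ and each remaining $y_j$ there by $b_{j-t,j}$. Lowering $L_d$: defined when row $d$ is a $\mathcal{V}$-row of rank $t$ and row $d-1$ is an $\mathcal{X}$-row (of rank $t+1$). All other rows are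 unchanged. 1. Wherever row $d-1$ has $x_j$ at position $p$ and row $d$ has $b_{jk}$ at position $p$, exchange them. Wherever row $d-1$ has $y_k$ at position $p$ and row $d$ has $a_{jk}$ at position $p+1$, move $a_{jk}$ to position $p$ of row $d-1$ and $y_k$ to position $p+1$ of row $d$. 2. Replace each remaining $a_{jk}$ in row $d-1$ by $x_j$ and each remaining $b_{jk}$ there by $y_k$. Replace each remaining $x_j$ in row $d$ by $a_{j,j+t}$ and each remaining $y_k$ there by $b_{k-t,k}$. -}

module Defs where

open import Data.Nat using (ℕ; zero; suc; _+_; _∸_; _≤_; _<_; _≡ᵇ_)
open import Data.Integer as ℤ using (ℤ; +_)
open import Data.Bool using (Bool; true; false; if_then_else_; not)
open import Data.List using (List; []; _∷_; length; map; applyUpTo)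
open import Data.List.Relation.Unary.All using (All)
open import Data.Maybe using (Maybe; just; nothing; fromMaybe)
open import Data.Product using (Σ; _×_)
open import Data.Sum using (_⊎_)
open import Data.Empty using (⊥)
open import Data.Unit using (⊤)
open import Relation.Binary.PropositionalEquality using (_≡_)

-- Symbols.  x i, y i are the symbols x_i, y_i; a i j, b i j are a_{ij},
-- b_{ij}; nat i is the integer entry i of row n.

data Sym : Set where
  x y : ℕ → Sym
  a b : ℕ → ℕ → Sym
  nat : ℕ → Sym

ValidSym : ℕ → Sym → Set
ValidSym n (x i)   = 1 ≤ i × i ≤ n
ValidSym n (y i)   = 1 ≤ i × i ≤ n
ValidSym n (a i j) = 1 ≤ i × i < j × j ≤ n
ValidSym n (b i j) = 1 ≤ i × i < j × j ≤ n
ValidSym n (nat i) = ⊥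

data InX : Sym → Set where
  inx : ∀ i → InX (x i)
  iny : ∀ i → InX (y i)

data InV (k : ℕ) : Sym → Set where
  ina : ∀ {i j} → j ≡ i + k → InV k (a i j)
  inb : ∀ {i j} → j ≡ i + k → InV k (b i j)

data IsXsym : Sym → Set where
  isx : ∀ i → IsXsym (x i)

data IsYsym : Sym → Set where
  isy : ∀ j → IsYsym (y j)

-- Triangles.  A triangle of order n is stored as the list of its rows
-- 1..n (row r at list index r-1); row 0 is the notional empty row.

Row : Set
Row = List Sym

Triangle : Set
Triangle = List Row

lk : {A : Set} → List A → ℕ → Maybe A
lk []       _       = nothing
lk (z ∷ zs) zero    = just z
lk (z ∷ zs) (suc i) = lk zs i

rowOf : Triangle → ℕ → Row
rowOf T zero    = []
rowOf T (suc r) = fromMaybe [] (lk T r)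

-- entry at position p (1-based) of row r
entry : Triangle → ℕ → ℕ → Maybe Sym
entry T r p = lk (rowOf T r) (p ∸ 1)

IsTriangle : ℕ → Triangle → Set
IsTriangle n T =
  length T ≡ n
  × (∀ r → 1 ≤ r → r ≤ n → length (rowOf T r) ≡ r)
  × rowOf T n ≡ map nat (applyUpTo suc n)
  × (∀ r → 1 ≤ r → r ≤ n ∸ 1 → All (ValidSym n) (rowOf T r))

-- 𝒳-rows and 𝒱-rows (row 0 = [] is automatically both)
XRow : Row → Set
XRow = All InX

VRow : Row → Set
VRow ρw = Σ ℕ λ k → All (InV k) ρw

IsRanking : ℕ → Triangle → (ℕ → ℕ) → Set
IsRanking n T ρ =
  ρ n ≡ 0 × ρ (n ∸ 1) ≡ 1
  × (∀ r → 1 ≤ r → r ≤ n ∸ 1 →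
       (XRow (rowOf T r) × ρ (r ∸ 1) ≡ ρ r)
       ⊎ (All (InV (ρ r)) (rowOf T r) × ρ (r ∸ 1) ≡ suc (ρ r)))

lv : ℕ → Sym → ℤ
lv t (x i)   = + i
lv t (y j)   = + j ℤ.- + t
lv t (a i j) = + i
lv t (b i j) = + i
lv t (nat i) = + i

rv : ℕ → Sym → ℤ
rv t (x i)   = + (i + t)
rv t (y j)   = + j
rv t (a i j) = + j
rv t (b i j) = + j
rv t (nat i) = + i

IsArrangementAt : Triangle → ℕ → ℕ → ℕ → Sym → Sym → Sym → Set
IsArrangementAt T n e p u v w =
  2 ≤ e × e ≤ n × 1 ≤ p × p ≤ e ∸ 1
  × entry T e p ≡ just u × entry T (e ∸ 1) p ≡ just v × entry T e (suc p) ≡ just w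

MonotoneDiagonal : ℕ → Triangle → (ℕ → ℕ) → Set
MonotoneDiagonal n T ρ =
  ∀ e p u v w → IsArrangementAt T n e p u v w →
    (lv (ρ e) u ℤ.≤ lv (ρ (e ∸ 1)) v)
    × (rv (ρ (e ∸ 1)) v ℤ.≤ rv (ρ e) w)
    × (IsYsym u → lv (ρ e) u ℤ.< lv (ρ (e ∸ 1)) v)
    × (IsXsym w → rv (ρ (e ∸ 1)) v ℤ.< rv (ρ e) w)

MonotoneRow : ℕ → Triangle → (ℕ → ℕ) → Set
MonotoneRow n T ρ =
  ∀ e p u v w → IsArrangementAt T n e p u v w → lv (ρ e) u ℤ.< lv (ρ e) w

Admissible : ℕ → Triangle → Set
Admissible n T =
  IsTriangle n T
  × Σ (ℕ → ℕ) λ ρ → IsRanking n T ρ × MonotoneDiagonal n T ρ × MonotoneRow n T ρ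

-- Rank of a row, computed intrinsically: for a ranked triangle and
-- 1 ≤ r ≤ n-1, the (unique) rank of row r equals
-- 1 + #{ s : r < s ≤ n-1, row s is not an 𝒳-row }.

isXb : Sym → Bool
isXb (x _) = true
isXb (y _) = true
isXb _     = false

allX : Row → Bool
allX []       = true
allX (s ∷ ss) = if isXb s then allX ss else false

countNonX : Triangle → ℕ → ℕ → ℕ
countNonX T s zero    = 0
countNonX T s (suc m) =
  (if allX (rowOf T s) then 0 else 1) + countNonX T (suc s) m

rankOf : ℕ → Triangle → ℕ → ℕ
rankOf n T r = suc (countNonX T (suc r) (n ∸ 1 ∸ r))

imapFrom : {A B : Set} → ℕ → (ℕ → A → B) → List A → List B
imapFrom i f []       = []
imapFrom i f (z ∷ zs) = f i z ∷ imapFrom (suc i) f zs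

setAt : {A : Set} → List A → ℕ → A → List A
setAt []       _       _ = []
setAt (z ∷ zs) zero    v = v ∷ zs
setAt (z ∷ zs) (suc i) v = z ∷ setAt zs i v

-- replace row r (r ≥ 1); row 0 is not stored
setRow : Triangle → ℕ → Row → Triangle
setRow T zero    _ = T
setRow T (suc r) w = setAt T r w

prevIn : Row → ℕ → Maybe Sym
prevIn R zero    = nothing
prevIn R (suc i) = lk R i

toX : Sym → Sym
toX (a j k) = x j
toX (b j k) = y k
toX s       = s

toV : ℕ → Sym → Sym
toV t (x i) = a i (i + t)
toV t (y j) = b (j ∸ t) j
toV t s     = s

pB : Maybe Sym → Maybe Sym → Bool
pB (just (b j k)) (just (x j')) = j ≡ᵇ j'
pB _ _ = false

pA : Maybe Sym → Maybe Sym → Bool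
pA (just (a j k)) (just (y k')) = k ≡ᵇ k'
pA _ _ = false

qB : Maybe Sym → Maybe Sym → Bool
qB (just (x j)) (just (b j' k)) = j ≡ᵇ j'
qB _ _ = false

qA : Maybe Sym → Maybe Sym → Bool
qA (just (y k)) (just (a j k')) = k ≡ᵇ k'
qA _ _ = false

-- R = row d-1 (𝒱-row), S = row d (𝒳-row); t = common rank
raiseUpper : Row → Row → Row
raiseUpper R S = imapFrom 0 f R
  where
  f : ℕ → Sym → Sym
  f i r = if pB (just r) (lk S i) then fromMaybe r (lk S i)
          else if pA (just r) (lk S (suc i)) then fromMaybe r (lk S (suc i))
          else toX r

raiseLower : ℕ → Row → Row → Row
raiseLower t R S = imapFrom 0 g S
  where
  g : ℕ → Sym → Sym
  g i s = if pB (lk R i) (just s) then fromMaybe s (lk R i)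
          else if pA (prevIn R i) (just s) then fromMaybe s (prevIn R i)
          else toV t s

-- U = row d-1 (𝒳-row), W = row d (𝒱-row of rank t)
lowerUpper : ℕ → Row → Row → Row
lowerUpper t U W = imapFrom 0 f U
  where
  f : ℕ → Sym → Sym
  f i u = if qB (just u) (lk W i) then fromMaybe u (lk W i)
          else if qA (just u) (lk W (suc i)) then fromMaybe u (lk W (suc i))
          else toV t u

lowerLower : Row → Row → Row
lowerLower U W = imapFrom 0 g W
  where
  g : ℕ → Sym → Sym
  g i w = if qB (lk U i) (just w) then fromMaybe w (lk U i)
          else if qA (prevIn U i) (just w) then fromMaybe w (prevIn U i)
          else toX w

raise : ℕ → ℕ → Triangle → Triangle
raise n d T =
  setRow (setRow T d (raiseLower (rankOf n T d) (rowOf T (d ∸ 1)) (rowOf T d)))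
         (d ∸ 1) (raiseUpper (rowOf T (d ∸ 1)) (rowOf T d))

lower : ℕ → ℕ → Triangle → Triangle
lower n d T =
  setRow (setRow T d (lowerLower (rowOf T (d ∸ 1)) (rowOf T d)))
         (d ∸ 1) (lowerUpper (rankOf n T d) (rowOf T (d ∸ 1)) (rowOf T d))

{-# OPTIONS --safe #-}
module Submission where

-- R_d and L_d are both local exchanges between the adjacent rows d-1 and d:
-- an upper entry trades places with the lower entry directly below it
-- ("vertical" pair) or below and to the right of it ("diagonal" pair), and
-- every other entry is converted (a ↔ x, b ↔ y).  The conversions of R_d and
-- L_d are mutually inverse on 𝒱_t- and 𝒳-entries, so L_d undoes R_d (and
-- vice versa) as soon as it exchanges exactly the pairs that R_d exchanged.
-- A pair that was exchanged is recognised again, transposed, and an entry that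
-- was moved can never belong to a pair of the other kind.  The only danger is
-- that two converted entries accidentally form a new pair, e.g. x_j above
-- b_{m-t,m} with j = m - t; the monotone diagonal property of the arrangement
-- they came from excludes exactly this, once the ranks computed by rankOf are
-- identified with those of the admissible ranking.

open import Defs
open import Data.Bool using (Bool; true; false; if_then_else_)
open import Data.Bool.Properties using (¬-not; T-≡)
open import Data.Integer as ℤ using (+_)
import Data.Integer.Properties as ℤP
open import Data.List using (List; []; _∷_; length)
open import Data.List.Relation.Unary.All as All using (All; []; _∷_)
open import Data.Maybe using (Maybe; just; nothing; fromMaybe; map)
import Data.Maybe.Relation.Unary.All as Maybe
open import Data.Nat using (ℕ; zero; suc; _+_; _∸_; _≤_; _<_; z≤n; s≤s; _≡ᵇ_)
open import Data.Nat.Properties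
  using ( +-identityʳ; +-suc; +-cancelʳ-≡; +-cancelʳ-<; m+[n∸m]≡n; m∸n+n≡m; m+n∸n≡m
        ; m≤n⇒m∸n≡0; m∸n≤m; m≤m+n; m≤n+m; n≤1+n; ≤-refl; ≤-reflexive; ≤-trans; ≤-total
        ; <⇒≤; <⇒≢; <-irrefl; 1+n≢n; ≡ᵇ⇒≡; ≡⇒≡ᵇ )
open import Data.Product using (_×_; _,_; ∃; ∃₂; proj₁; proj₂)
open import Data.Sum using (_⊎_; inj₁; inj₂)
open import Function using (_∘_; case_of_)
open import Function.Bundles using (Equivalence)
open import Relation.Binary.PropositionalEquality
open import Relation.Nullary using (contradiction)
open ≡-Reasoning

-- Lists indexed by ℕ

lk-imapFrom : ∀ {A B : Set} s (f : ℕ → A → B) xs i →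
              lk (imapFrom s f xs) i ≡ map (f (s + i)) (lk xs i)
lk-imapFrom s f []       i       = refl
lk-imapFrom s f (z ∷ zs) zero    = cong (λ k → just (f k z)) (sym (+-identityʳ s))
lk-imapFrom s f (z ∷ zs) (suc i) =
  trans (lk-imapFrom (suc s) f zs i) (cong (λ k → map (f k) (lk zs i)) (sym (+-suc s i)))

lk-ext : ∀ {A : Set} (xs ys : List A) → (∀ i → lk xs i ≡ lk ys i) → xs ≡ ys
lk-ext []       []       _  = refl
lk-ext []       (_ ∷ _)  eq with () ← eq 0
lk-ext (_ ∷ _)  []       eq with () ← eq 0
lk-ext (z ∷ zs) (w ∷ ws) eq with refl ← eq 0 = cong (z ∷_) (lk-ext zs ws (eq ∘ suc))

lk-just : ∀ {A : Set} (xs : List A) i → i < length xs → ∃ λ z → lk xs i ≡ just z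
lk-just (z ∷ zs) zero    _         = z , refl
lk-just (z ∷ zs) (suc i) (s≤s i<n) = lk-just zs i i<n

lk-length : ∀ {A : Set} (xs : List A) i {z} → lk xs i ≡ just z → i < length xs
lk-length (_ ∷ zs) zero    _  = s≤s z≤n
lk-length (_ ∷ zs) (suc i) eq = s≤s (lk-length zs i eq)

lk-All : ∀ {A : Set} {P : A → Set} {xs} → All P xs → ∀ i → Maybe.All P (lk xs i)
lk-All []       i       = Maybe.nothing
lk-All (p ∷ ps) zero    = Maybe.just p
lk-All (p ∷ ps) (suc i) = lk-All ps i

All-lk : ∀ {A : Set} {P : A → Set} {xs} → All P xs → ∀ i {z} → lk xs i ≡ just z → P z
All-lk ps i eq = Maybe.drop-just (subst (Maybe.All _) eq (lk-All ps i))

map-inverse : ∀ {A : Set} {f g : A → A} {m} → Maybe.All (λ s → f (g s) ≡ s) m → map f (map g m) ≡ m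
map-inverse (Maybe.just eq) = cong just eq
map-inverse Maybe.nothing   = refl

setAt-comm : ∀ {A : Set} (xs : List A) i j v w → i ≢ j →
             setAt (setAt xs i v) j w ≡ setAt (setAt xs j w) i v
setAt-comm []       _       _       _ _ _  = refl
setAt-comm (z ∷ zs) zero    zero    _ _ ne = contradiction refl ne
setAt-comm (z ∷ zs) zero    (suc j) _ _ _  = refl
setAt-comm (z ∷ zs) (suc i) zero    _ _ _  = refl
setAt-comm (z ∷ zs) (suc i) (suc j) v w ne = cong (z ∷_) (setAt-comm zs i j v w (ne ∘ cong suc))

setAt-idem : ∀ {A : Set} (xs : List A) i v w → setAt (setAt xs i v) i w ≡ setAt xs i w
setAt-idem []       _       _ _ = refl
setAt-idem (z ∷ zs) zero    _ _ = refl
setAt-idem (z ∷ zs) (suc i) v w = cong (z ∷_) (setAt-idem zs i v w)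

setAt-lk : ∀ {A : Set} (xs : List A) i {v} → lk xs i ≡ just v → setAt xs i v ≡ xs
setAt-lk (z ∷ zs) zero    refl = refl
setAt-lk (z ∷ zs) (suc i) eq   = cong (z ∷_) (setAt-lk zs i eq)

lk-setAt-≡ : ∀ {A : Set} (xs : List A) i v → i < length xs → lk (setAt xs i v) i ≡ just v
lk-setAt-≡ (z ∷ zs) zero    v _         = refl
lk-setAt-≡ (z ∷ zs) (suc i) v (s≤s i<n) = lk-setAt-≡ zs i v i<n

lk-setAt-≢ : ∀ {A : Set} (xs : List A) i j v → i ≢ j → lk (setAt xs i v) j ≡ lk xs j
lk-setAt-≢ []       _       _       _ _  = refl
lk-setAt-≢ (z ∷ zs) zero    zero    _ ne = contradiction refl ne
lk-setAt-≢ (z ∷ zs) zero    (suc j) _ _  = refl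
lk-setAt-≢ (z ∷ zs) (suc i) zero    _ _  = refl
lk-setAt-≢ (z ∷ zs) (suc i) (suc j) v ne = lk-setAt-≢ zs i j v (ne ∘ cong suc)

length-setAt : ∀ {A : Set} (xs : List A) i v → length (setAt xs i v) ≡ length xs
length-setAt []       _       _ = refl
length-setAt (z ∷ zs) zero    _ = refl
length-setAt (z ∷ zs) (suc i) v = cong suc (length-setAt zs i v)

-- Exchanges between two adjacent rows

true-or-false : ∀ β → β ≡ true ⊎ β ≡ false
true-or-false true  = inj₁ refl
true-or-false false = inj₂ refl

just-fromMaybe : ∀ {A : Set} {s : A} (P : Maybe A → Bool) m → P nothing ≡ false → P m ≡ true →
                 just (fromMaybe s m) ≡ m
just-fromMaybe P (just _) _  _  = refl
just-fromMaybe P nothing  p₀ p = contradiction (trans (sym p) p₀) λ ()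

-- Step 1 of R_d and L_d: the entry u at position p of the upper row is exchanged
-- with the entry l at position p (if vertical u l) or p+1 (if diagonal u l) of
-- the lower row.  Step 2: the remaining entries are converted.  In the laws,
-- ᵘ and ˡ mark two pairs that share their upper or their lower entry.
record ExchangeRule : Set where
  field
    vertical diagonal   : Maybe Sym → Maybe Sym → Bool
    convUpper convLower : Sym → Sym
    vertical-nothingˡ   : ∀ l → vertical nothing l ≡ false
    vertical-nothingʳ   : ∀ u → vertical u nothing ≡ false
    diagonal-nothingˡ   : ∀ l → diagonal nothing l ≡ false
    diagonal-nothingʳ   : ∀ u → diagonal u nothing ≡ false
    diagonal⇒¬verticalᵘ : ∀ {u l l′} → diagonal u l ≡ true → vertical u l′ ≡ false
    diagonal⇒¬verticalˡ : ∀ {u u′ l} → diagonal u l ≡ true → vertical u′ l ≡ false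

  swapUpper : Row → Row → Row
  swapUpper U L = imapFrom 0 (λ i u →
    if vertical (just u) (lk L i) then fromMaybe u (lk L i)
    else if diagonal (just u) (lk L (suc i)) then fromMaybe u (lk L (suc i))
    else convUpper u) U

  swapLower : Row → Row → Row
  swapLower U L = imapFrom 0 (λ i l →
    if vertical (lk U i) (just l) then fromMaybe l (lk U i)
    else if diagonal (prevIn U i) (just l) then fromMaybe l (prevIn U i)
    else convLower l) L

  upperCell : Maybe Sym → Maybe Sym → Maybe Sym → Maybe Sym
  upperCell u l l⁺ = if vertical u l then l else if diagonal u l⁺ then l⁺ else map convUpper u

  lowerCell : Maybe Sym → Maybe Sym → Maybe Sym → Maybe Sym
  lowerCell u⁻ u l = if vertical u l then u else if diagonal u⁻ l then u⁻ else map convLower l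

  lk-swapUpper : ∀ U L i → lk (swapUpper U L) i ≡ upperCell (lk U i) (lk L i) (lk L (suc i))
  lk-swapUpper U L i = trans (lk-imapFrom 0 _ U i) (cell (lk U i) (lk L i) (lk L (suc i)))
    where
    cell : ∀ u l l⁺ → map (λ r → if vertical (just r) l then fromMaybe r l
                                 else if diagonal (just r) l⁺ then fromMaybe r l⁺
                                 else convUpper r) u
                      ≡ upperCell u l l⁺
    cell nothing l l⁺ rewrite vertical-nothingˡ l | diagonal-nothingˡ l⁺ = refl
    cell (just r) l l⁺ with vertical (just r) l in v
    ... | true = just-fromMaybe (vertical (just r)) l (vertical-nothingʳ (just r)) v
    ... | false with diagonal (just r) l⁺ in d
    ...   | true  = just-fromMaybe (diagonal (just r)) l⁺ (diagonal-nothingʳ (just r)) d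
    ...   | false = refl

  lk-swapLower : ∀ U L i → lk (swapLower U L) i ≡ lowerCell (prevIn U i) (lk U i) (lk L i)
  lk-swapLower U L i = trans (lk-imapFrom 0 _ L i) (cell (prevIn U i) (lk U i) (lk L i))
    where
    cell : ∀ u⁻ u l → map (λ s → if vertical u (just s) then fromMaybe s u
                                 else if diagonal u⁻ (just s) then fromMaybe s u⁻
                                 else convLower s) l
                      ≡ lowerCell u⁻ u l
    cell u⁻ u nothing rewrite vertical-nothingʳ u | diagonal-nothingʳ u⁻ = refl
    cell u⁻ u (just s) with vertical u (just s) in v
    ... | true = just-fromMaybe (λ m → vertical m (just s)) u (vertical-nothingˡ (just s)) v
    ... | false with diagonal u⁻ (just s) in d
    ...   | true  = just-fromMaybe (λ m → diagonal m (just s)) u⁻ (diagonal-nothingˡ (just s)) d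
    ...   | false = refl

  prevIn-swapUpper : ∀ U L i → prevIn (swapUpper U L) i ≡ upperCell (prevIn U i) (prevIn L i) (lk L i)
  prevIn-swapUpper U L zero    rewrite vertical-nothingˡ nothing | diagonal-nothingˡ (lk L 0) = refl
  prevIn-swapUpper U L (suc i) = lk-swapUpper U L i

  vertical⇒¬diagonalᵘ : ∀ {u l l′} → vertical u l ≡ true → diagonal u l′ ≡ false
  vertical⇒¬diagonalᵘ v = ¬-not λ d → contradiction (trans (sym v) (diagonal⇒¬verticalᵘ d)) λ ()

  upperCell-vertical : ∀ {u l l⁺} → vertical u l ≡ true → upperCell u l l⁺ ≡ l
  upperCell-vertical v rewrite v = refl

  upperCell-diagonal : ∀ {u l l⁺} → vertical u l ≡ false → diagonal u l⁺ ≡ true →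
                       upperCell u l l⁺ ≡ l⁺
  upperCell-diagonal v d rewrite v | d = refl

  upperCell-neither : ∀ {u l l⁺} → vertical u l ≡ false → diagonal u l⁺ ≡ false →
                      upperCell u l l⁺ ≡ map convUpper u
  upperCell-neither v d rewrite v | d = refl

  lowerCell-vertical : ∀ {u⁻ u l} → vertical u l ≡ true → lowerCell u⁻ u l ≡ u
  lowerCell-vertical v rewrite v = refl

  lowerCell-diagonal : ∀ {u⁻ u l} → vertical u l ≡ false → diagonal u⁻ l ≡ true →
                       lowerCell u⁻ u l ≡ u⁻
  lowerCell-diagonal v d rewrite v | d = refl

  lowerCell-neither : ∀ {u⁻ u l} → vertical u l ≡ false → diagonal u⁻ l ≡ false →
                      lowerCell u⁻ u l ≡ map convLower l
  lowerCell-neither v d rewrite v | d = refl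

exchange : ExchangeRule → Row × Row → Row × Row
exchange E (U , L) = swapUpper U L , swapLower U L
  where open ExchangeRule E

module _ (F E : ExchangeRule) where
  private
    module F = ExchangeRule F
    module E = ExchangeRule E

  -- After E, the lower entry l of an E-pair sits in the upper row (ᵘ) and u in
  -- the lower row (ˡ).
  record Reverses : Set where
    field
      vertical-transpose  : ∀ {u l} → E.vertical u l ≡ true → F.vertical l u ≡ true
      diagonal-transpose  : ∀ {u l} → E.diagonal u l ≡ true → F.diagonal l u ≡ true
      vertical⇒¬diagonalᵘ : ∀ {u l l′} → E.vertical u l ≡ true → F.diagonal l l′ ≡ false
      vertical⇒¬diagonalˡ : ∀ {u l u′} → E.vertical u l ≡ true → F.diagonal u′ u ≡ false
      diagonal⇒¬verticalᵘ : ∀ {u l l′} → E.diagonal u l ≡ true → F.vertical l l′ ≡ false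
      diagonal⇒¬verticalˡ : ∀ {u l u′} → E.diagonal u l ≡ true → F.vertical u′ u ≡ false

module Undo {F E : ExchangeRule} (reverses : Reverses F E) where
  open Reverses reverses
  private
    module F = ExchangeRule F
    module E = ExchangeRule E

  detect-vertical : ∀ {u⁻ u l l⁺ β} → F.vertical (map E.convUpper u) (map E.convLower l) ≡ false →
                    E.vertical u l ≡ β → F.vertical (E.upperCell u l l⁺) (E.lowerCell u⁻ u l) ≡ β
  detect-vertical {β = true} fresh v =
    trans (cong₂ F.vertical (E.upperCell-vertical v) (E.lowerCell-vertical v)) (vertical-transpose v)
  detect-vertical {u⁻} {u} {l} {l⁺} {false} fresh v
    with true-or-false (E.diagonal u l⁺) | true-or-false (E.diagonal u⁻ l)
  ... | inj₁ d | _       =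
    trans (cong (λ m → F.vertical m _) (E.upperCell-diagonal v d)) (diagonal⇒¬verticalᵘ d)
  ... | inj₂ d | inj₁ d⁻ =
    trans (cong₂ F.vertical (E.upperCell-neither v d) (E.lowerCell-diagonal v d⁻)) (diagonal⇒¬verticalˡ d⁻)
  ... | inj₂ d | inj₂ d⁻ =
    trans (cong₂ F.vertical (E.upperCell-neither v d) (E.lowerCell-neither v d⁻)) fresh

  detect-diagonal : ∀ {u u⁺ l l⁺ β} → F.diagonal (map E.convUpper u) (map E.convLower l⁺) ≡ false →
                    E.diagonal u l⁺ ≡ β → F.diagonal (E.upperCell u l l⁺) (E.lowerCell u u⁺ l⁺) ≡ β
  detect-diagonal {u} {u⁺} {l} {l⁺} {β} fresh d with true-or-false (E.vertical u l)
  ... | inj₁ v = begin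
    F.diagonal (E.upperCell u l l⁺) (E.lowerCell u u⁺ l⁺) ≡⟨ cong (λ m → F.diagonal m _) (E.upperCell-vertical v) ⟩
    F.diagonal l (E.lowerCell u u⁺ l⁺)                     ≡⟨ vertical⇒¬diagonalᵘ v ⟩
    false                                                  ≡⟨ E.vertical⇒¬diagonalᵘ v ⟨
    E.diagonal u l⁺                                        ≡⟨ d ⟩
    β                                                      ∎
  detect-diagonal {β = true} fresh d | inj₂ v =
    trans (cong₂ F.diagonal (E.upperCell-diagonal v d) (E.lowerCell-diagonal (E.diagonal⇒¬verticalˡ d) d))
          (diagonal-transpose d)
  detect-diagonal {u} {u⁺} {l} {l⁺} {false} fresh d | inj₂ v with true-or-false (E.vertical u⁺ l⁺)
  ... | inj₁ v⁺ =
    trans (cong₂ F.diagonal (E.upperCell-neither v d) (E.lowerCell-vertical v⁺)) (vertical⇒¬diagonalˡ v⁺)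
  ... | inj₂ v⁺ =
    trans (cong₂ F.diagonal (E.upperCell-neither v d) (E.lowerCell-neither v⁺ d)) fresh

  upperCell-undone : ∀ {u⁻ u u⁺ l l⁺} → map F.convUpper (map E.convUpper u) ≡ u →
    F.vertical (map E.convUpper u) (map E.convLower l) ≡ false →
    F.diagonal (map E.convUpper u) (map E.convLower l⁺) ≡ false →
    F.upperCell (E.upperCell u l l⁺) (E.lowerCell u⁻ u l) (E.lowerCell u u⁺ l⁺) ≡ u
  upperCell-undone {u⁻} {u} {u⁺} {l} {l⁺} inverse freshV freshD
    with true-or-false (E.vertical u l) | true-or-false (E.diagonal u l⁺)
  ... | inj₁ v | _      =
    trans (F.upperCell-vertical (detect-vertical freshV v)) (E.lowerCell-vertical v)
  ... | inj₂ v | inj₁ d =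
    trans (F.upperCell-diagonal (detect-vertical freshV v) (detect-diagonal freshD d))
          (E.lowerCell-diagonal (E.diagonal⇒¬verticalˡ d) d)
  ... | inj₂ v | inj₂ d =
    trans (F.upperCell-neither (detect-vertical freshV v) (detect-diagonal freshD d))
          (trans (cong (map F.convUpper) (E.upperCell-neither v d)) inverse)

  lowerCell-undone : ∀ {u⁻ u l⁻ l l⁺} → map F.convLower (map E.convLower l) ≡ l →
    F.vertical (map E.convUpper u) (map E.convLower l) ≡ false →
    F.diagonal (map E.convUpper u⁻) (map E.convLower l) ≡ false →
    F.lowerCell (E.upperCell u⁻ l⁻ l) (E.upperCell u l l⁺) (E.lowerCell u⁻ u l) ≡ l
  lowerCell-undone {u⁻} {u} {l⁻} {l} {l⁺} inverse freshV freshD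
    with true-or-false (E.vertical u l) | true-or-false (E.diagonal u⁻ l)
  ... | inj₁ v | _      =
    trans (F.lowerCell-vertical (detect-vertical freshV v)) (E.upperCell-vertical v)
  ... | inj₂ v | inj₁ d =
    trans (F.lowerCell-diagonal (detect-vertical freshV v) (detect-diagonal freshD d))
          (E.upperCell-diagonal (E.diagonal⇒¬verticalᵘ d) d)
  ... | inj₂ v | inj₂ d =
    trans (F.lowerCell-neither (detect-vertical freshV v) (detect-diagonal freshD d))
          (trans (cong (map F.convLower) (E.lowerCell-neither v d)) inverse)

  -- The last two hypotheses: converting the entries that E leaves in place never
  -- creates a pair that F would exchange.
  exchange-undone : ∀ U L →
    All (λ u → F.convUpper (E.convUpper u) ≡ u) U →
    All (λ l → F.convLower (E.convLower l) ≡ l) L →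
    (∀ i → F.vertical (map E.convUpper (lk U i)) (map E.convLower (lk L i)) ≡ false) →
    (∀ i → F.diagonal (map E.convUpper (lk U i)) (map E.convLower (lk L (suc i))) ≡ false) →
    exchange F (exchange E (U , L)) ≡ (U , L)
  exchange-undone U L inverseU inverseL freshV freshD =
    cong₂ _,_ (lk-ext _ U upperRow) (lk-ext _ L lowerRow)
    where
    U′ = E.swapUpper U L
    L′ = E.swapLower U L

    upperRow : ∀ i → lk (F.swapUpper U′ L′) i ≡ lk U i
    upperRow i rewrite F.lk-swapUpper U′ L′ i | E.lk-swapUpper U L i
                     | E.lk-swapLower U L i | E.lk-swapLower U L (suc i)
      = upperCell-undone (map-inverse (lk-All inverseU i)) (freshV i) (freshD i)

    freshD⁻ : ∀ i → F.diagonal (map E.convUpper (prevIn U i)) (map E.convLower (lk L i)) ≡ false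
    freshD⁻ zero    = F.diagonal-nothingˡ _
    freshD⁻ (suc i) = freshD i

    lowerRow : ∀ i → lk (F.swapLower U′ L′) i ≡ lk L i
    lowerRow i rewrite F.lk-swapLower U′ L′ i | E.prevIn-swapUpper U L i
                     | E.lk-swapUpper U L i | E.lk-swapLower U L i
      = lowerCell-undone (map-inverse (lk-All inverseL i)) (freshV i) (freshD⁻ i)

-- Raising and lowering as exchanges

≡ᵇ-true⇒≡ : ∀ {m n} → (m ≡ᵇ n) ≡ true → m ≡ n
≡ᵇ-true⇒≡ {m} {n} eq = ≡ᵇ⇒≡ m n (Equivalence.from T-≡ eq)

≡ᵇ-refl : ∀ n → (n ≡ᵇ n) ≡ true
≡ᵇ-refl n = Equivalence.to T-≡ (≡⇒≡ᵇ n n refl)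

≢⇒≡ᵇ-false : ∀ {m n} → m ≢ n → (m ≡ᵇ n) ≡ false
≢⇒≡ᵇ-false m≢n = ¬-not (m≢n ∘ ≡ᵇ-true⇒≡)

pB-true : ∀ {u l} → pB u l ≡ true → ∃₂ λ j k → u ≡ just (b j k) × l ≡ just (x j)
pB-true {just (b j k)} {just (x j′)} eq = j , k , refl , cong (λ i → just (x i)) (sym (≡ᵇ-true⇒≡ eq))
pB-true {nothing}                     ()
pB-true {just (x _)}                  ()
pB-true {just (y _)}                  ()
pB-true {just (a _ _)}                ()
pB-true {just (nat _)}                ()
pB-true {just (b _ _)} {nothing}      ()
pB-true {just (b _ _)} {just (y _)}   ()
pB-true {just (b _ _)} {just (a _ _)} ()
pB-true {just (b _ _)} {just (b _ _)} ()
pB-true {just (b _ _)} {just (nat _)} ()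

pA-true : ∀ {u l} → pA u l ≡ true → ∃₂ λ j k → u ≡ just (a j k) × l ≡ just (y k)
pA-true {just (a j k)} {just (y k′)} eq = j , k , refl , cong (λ i → just (y i)) (sym (≡ᵇ-true⇒≡ eq))
pA-true {nothing}                     ()
pA-true {just (x _)}                  ()
pA-true {just (y _)}                  ()
pA-true {just (b _ _)}                ()
pA-true {just (nat _)}                ()
pA-true {just (a _ _)} {nothing}      ()
pA-true {just (a _ _)} {just (x _)}   ()
pA-true {just (a _ _)} {just (a _ _)} ()
pA-true {just (a _ _)} {just (b _ _)} ()
pA-true {just (a _ _)} {just (nat _)} ()

qB-true : ∀ {u l} → qB u l ≡ true → ∃₂ λ j k → u ≡ just (x j) × l ≡ just (b j k)
qB-true {just (x j)} {just (b j′ k)} eq = j , k , refl , cong (λ i → just (b i k)) (sym (≡ᵇ-true⇒≡ eq))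
qB-true {nothing}                   ()
qB-true {just (y _)}                ()
qB-true {just (a _ _)}              ()
qB-true {just (b _ _)}              ()
qB-true {just (nat _)}              ()
qB-true {just (x _)} {nothing}      ()
qB-true {just (x _)} {just (x _)}   ()
qB-true {just (x _)} {just (y _)}   ()
qB-true {just (x _)} {just (a _ _)} ()
qB-true {just (x _)} {just (nat _)} ()

qA-true : ∀ {u l} → qA u l ≡ true → ∃₂ λ j k → u ≡ just (y k) × l ≡ just (a j k)
qA-true {just (y k)} {just (a j k′)} eq = j , k , refl , cong (λ i → just (a j i)) (sym (≡ᵇ-true⇒≡ eq))
qA-true {nothing}                   ()
qA-true {just (x _)}                ()
qA-true {just (a _ _)}              ()
qA-true {just (b _ _)}              ()
qA-true {just (nat _)}              ()
qA-true {just (y _)} {nothing}      ()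
qA-true {just (y _)} {just (x _)}   ()
qA-true {just (y _)} {just (y _)}   ()
qA-true {just (y _)} {just (b _ _)} ()
qA-true {just (y _)} {just (nat _)} ()

pB-y : ∀ u m → pB u (just (y m)) ≡ false
pB-y u m = ¬-not λ eq → case pB-true {u} eq of λ { (_ , _ , _ , ()) }

pA-x : ∀ u m → pA u (just (x m)) ≡ false
pA-x u m = ¬-not λ eq → case pA-true {u} eq of λ { (_ , _ , _ , ()) }

qB-a : ∀ u j k → qB u (just (a j k)) ≡ false
qB-a u j k = ¬-not λ eq → case qB-true {u} eq of λ { (_ , _ , _ , ()) }

qA-b : ∀ u j k → qA u (just (b j k)) ≡ false
qA-b u j k = ¬-not λ eq → case qA-true {u} eq of λ { (_ , _ , _ , ()) }

raising : ℕ → ExchangeRule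
raising t = record
  { vertical            = pB
  ; diagonal            = pA
  ; convUpper           = toX
  ; convLower           = toV t
  ; vertical-nothingˡ   = λ _ → refl
  ; vertical-nothingʳ   = λ u → ¬-not λ eq → case pB-true {u} eq of λ { (_ , _ , _ , ()) }
  ; diagonal-nothingˡ   = λ _ → refl
  ; diagonal-nothingʳ   = λ u → ¬-not λ eq → case pA-true {u} eq of λ { (_ , _ , _ , ()) }
  ; diagonal⇒¬verticalᵘ = λ {u} {l} d → case pA-true {u} {l} d of λ { (_ , _ , refl , _) → refl }
  ; diagonal⇒¬verticalˡ = λ {u} {u′} {l} d → case pA-true {u} {l} d of λ { (_ , _ , _ , refl) → pB-y u′ _ }
  }

lowering : ℕ → ExchangeRule
lowering t = record
  { vertical            = qB
  ; diagonal            = qA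
  ; convUpper           = toV t
  ; convLower           = toX
  ; vertical-nothingˡ   = λ _ → refl
  ; vertical-nothingʳ   = λ u → ¬-not λ eq → case qB-true {u} eq of λ { (_ , _ , _ , ()) }
  ; diagonal-nothingˡ   = λ _ → refl
  ; diagonal-nothingʳ   = λ u → ¬-not λ eq → case qA-true {u} eq of λ { (_ , _ , _ , ()) }
  ; diagonal⇒¬verticalᵘ = λ {u} {l} d → case qA-true {u} {l} d of λ { (_ , _ , refl , _) → refl }
  ; diagonal⇒¬verticalˡ = λ {u} {u′} {l} d → case qA-true {u} {l} d of λ { (_ , _ , _ , refl) → qB-a u′ _ _ }
  }

lowering-reverses-raising : ∀ {t} → Reverses (lowering t) (raising t)
lowering-reverses-raising = record
  { vertical-transpose  = λ {u} {l} v → case pB-true {u} {l} v of λ { (j , _ , refl , refl) → ≡ᵇ-refl j }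
  ; diagonal-transpose  = λ {u} {l} d → case pA-true {u} {l} d of λ { (_ , k , refl , refl) → ≡ᵇ-refl k }
  ; vertical⇒¬diagonalᵘ = λ {u} {l} v → case pB-true {u} {l} v of λ { (_ , _ , _ , refl) → refl }
  ; vertical⇒¬diagonalˡ = λ {u} {l} {u′} v → case pB-true {u} {l} v of λ { (_ , _ , refl , _) → qA-b u′ _ _ }
  ; diagonal⇒¬verticalᵘ = λ {u} {l} d → case pA-true {u} {l} d of λ { (_ , _ , _ , refl) → refl }
  ; diagonal⇒¬verticalˡ = λ {u} {l} {u′} d → case pA-true {u} {l} d of λ { (_ , _ , refl , _) → qB-a u′ _ _ }
  }

raising-reverses-lowering : ∀ {t} → Reverses (raising t) (lowering t)
raising-reverses-lowering = record
  { vertical-transpose  = λ {u} {l} v → case qB-true {u} {l} v of λ { (j , _ , refl , refl) → ≡ᵇ-refl j }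
  ; diagonal-transpose  = λ {u} {l} d → case qA-true {u} {l} d of λ { (_ , k , refl , refl) → ≡ᵇ-refl k }
  ; vertical⇒¬diagonalᵘ = λ {u} {l} v → case qB-true {u} {l} v of λ { (_ , _ , _ , refl) → refl }
  ; vertical⇒¬diagonalˡ = λ {u} {l} {u′} v → case qB-true {u} {l} v of λ { (_ , _ , refl , _) → pA-x u′ _ }
  ; diagonal⇒¬verticalᵘ = λ {u} {l} d → case qA-true {u} {l} d of λ { (_ , _ , _ , refl) → refl }
  ; diagonal⇒¬verticalˡ = λ {u} {l} {u′} d → case qA-true {u} {l} d of λ { (_ , _ , refl , _) → pB-y u′ _ }
  }

toV-toX : ∀ {t u} → InV t u → toV t (toX u) ≡ u
toV-toX     (ina refl)     = refl
toV-toX {t} (inb {i} refl) = cong (λ k → b k (i + t)) (m+n∸n≡m i t)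

toX-toV : ∀ {t l} → InX l → toX (toV t l) ≡ l
toX-toV (inx _) = refl
toX-toV (iny _) = refl

raising-fresh-vertical : ∀ {t r s} → Maybe.All (InV t) r → Maybe.All InX s →
  (∀ {j m} → r ≡ just (a j (j + t)) → s ≡ just (y m) → j ≢ m ∸ t) →
  qB (map toX r) (map (toV t) s) ≡ false
raising-fresh-vertical Maybe.nothing           _                    _  = refl
raising-fresh-vertical (Maybe.just (inb refl)) _                    _  = refl
raising-fresh-vertical (Maybe.just (ina refl)) Maybe.nothing        _  = refl
raising-fresh-vertical (Maybe.just (ina refl)) (Maybe.just (inx _)) _  = refl
raising-fresh-vertical (Maybe.just (ina refl)) (Maybe.just (iny _)) ne = ≢⇒≡ᵇ-false (ne refl refl)

raising-fresh-diagonal : ∀ {t r s} → Maybe.All (InV t) r → Maybe.All InX s →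
  (∀ {j m} → r ≡ just (b j (j + t)) → s ≡ just (x m) → j ≢ m) →
  qA (map toX r) (map (toV t) s) ≡ false
raising-fresh-diagonal     Maybe.nothing           _                    _  = refl
raising-fresh-diagonal     (Maybe.just (ina refl)) _                    _  = refl
raising-fresh-diagonal     (Maybe.just (inb refl)) Maybe.nothing        _  = refl
raising-fresh-diagonal     (Maybe.just (inb refl)) (Maybe.just (iny _)) _  = refl
raising-fresh-diagonal {t} (Maybe.just (inb refl)) (Maybe.just (inx _)) ne =
  ≢⇒≡ᵇ-false (ne refl refl ∘ +-cancelʳ-≡ t _ _)

lowering-fresh-vertical : ∀ {t u w} → Maybe.All InX u → Maybe.All (InV t) w →
  (∀ {j m} → u ≡ just (y m) → w ≡ just (a j (j + t)) → m ∸ t ≢ j) →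
  pB (map (toV t) u) (map toX w) ≡ false
lowering-fresh-vertical Maybe.nothing        _                       _  = refl
lowering-fresh-vertical (Maybe.just (inx _)) _                       _  = refl
lowering-fresh-vertical (Maybe.just (iny _)) Maybe.nothing           _  = refl
lowering-fresh-vertical (Maybe.just (iny _)) (Maybe.just (inb refl)) _  = refl
lowering-fresh-vertical (Maybe.just (iny _)) (Maybe.just (ina refl)) ne = ≢⇒≡ᵇ-false (ne refl refl)

lowering-fresh-diagonal : ∀ {t u w} → Maybe.All InX u → Maybe.All (InV t) w →
  (∀ {j m} → u ≡ just (x m) → w ≡ just (b j (j + t)) → m ≢ j) →
  pA (map (toV t) u) (map toX w) ≡ false
lowering-fresh-diagonal     Maybe.nothing        _                       _  = refl
lowering-fresh-diagonal     (Maybe.just (iny _)) _                       _  = refl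
lowering-fresh-diagonal     (Maybe.just (inx _)) Maybe.nothing           _  = refl
lowering-fresh-diagonal     (Maybe.just (inx _)) (Maybe.just (ina refl)) _  = refl
lowering-fresh-diagonal {t} (Maybe.just (inx _)) (Maybe.just (inb refl)) ne =
  ≢⇒≡ᵇ-false (ne refl refl ∘ +-cancelʳ-≡ t _ _)

-- Replacing two adjacent rows of a triangle

setRow-comm : ∀ T r s X Y → r ≢ s → setRow (setRow T r X) s Y ≡ setRow (setRow T s Y) r X
setRow-comm T zero    s       X Y _  = refl
setRow-comm T (suc r) zero    X Y _  = refl
setRow-comm T (suc r) (suc s) X Y ne = setAt-comm T r s X Y (ne ∘ cong suc)

setRow-idem : ∀ T r X Y → setRow (setRow T r X) r Y ≡ setRow T r Y
setRow-idem T zero    X Y = refl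
setRow-idem T (suc r) X Y = setAt-idem T r X Y

setRow-rowOf : ∀ T r → r ≤ length T → setRow T r (rowOf T r) ≡ T
setRow-rowOf T zero    _   = refl
setRow-rowOf T (suc r) r<n with lk-just T r r<n
... | _ , eq rewrite eq = setAt-lk T r eq

rowOf-setRow-≡ : ∀ T r X → r ≤ length T → (r ≡ 0 → X ≡ []) → rowOf (setRow T r X) r ≡ X
rowOf-setRow-≡ T zero    X _   empty = sym (empty refl)
rowOf-setRow-≡ T (suc r) X r<n _     = cong (fromMaybe []) (lk-setAt-≡ T r X r<n)

rowOf-setRow-≢ : ∀ T r s X → r ≢ s → rowOf (setRow T r X) s ≡ rowOf T s
rowOf-setRow-≢ T zero    s       X _  = refl
rowOf-setRow-≢ T (suc r) zero    X _  = refl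
rowOf-setRow-≢ T (suc r) (suc s) X ne = cong (fromMaybe []) (lk-setAt-≢ T r s X (ne ∘ cong suc))

length-setRow : ∀ T r X → length (setRow T r X) ≡ length T
length-setRow T zero    X = refl
length-setRow T (suc r) X = length-setAt T r X

rowPair : Triangle → ℕ → Row × Row
rowPair T d′ = rowOf T d′ , rowOf T (suc d′)

replaceRows : Triangle → ℕ → Row × Row → Triangle
replaceRows T d′ (U , L) = setRow (setRow T (suc d′) L) d′ U

replaceRows-replaceRows : ∀ T d′ P Q → replaceRows (replaceRows T d′ P) d′ Q ≡ replaceRows T d′ Q
replaceRows-replaceRows T d′ (U , L) (U′ , L′) = begin
  setRow (setRow (setRow (setRow T d L) d′ U) d L′) d′ U′
    ≡⟨ cong (λ T′ → setRow (setRow T′ d L′) d′ U′) (setRow-comm T d d′ L U 1+n≢n) ⟩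
  setRow (setRow (setRow (setRow T d′ U) d L) d L′) d′ U′
    ≡⟨ cong (λ T′ → setRow T′ d′ U′) (setRow-idem (setRow T d′ U) d L L′) ⟩
  setRow (setRow (setRow T d′ U) d L′) d′ U′
    ≡⟨ setRow-comm (setRow T d′ U) d d′ L′ U′ 1+n≢n ⟩
  setRow (setRow (setRow T d′ U) d′ U′) d L′
    ≡⟨ cong (λ T′ → setRow T′ d L′) (setRow-idem T d′ U U′) ⟩
  setRow (setRow T d′ U′) d L′
    ≡⟨ setRow-comm T d′ d U′ L′ (1+n≢n ∘ sym) ⟩
  setRow (setRow T d L′) d′ U′ ∎
  where d = suc d′

replaceRows-rowPair : ∀ T d′ → suc d′ ≤ length T → replaceRows T d′ (rowPair T d′) ≡ T
replaceRows-rowPair T d′ d≤ = begin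
  setRow (setRow T (suc d′) (rowOf T (suc d′))) d′ (rowOf T d′)
    ≡⟨ cong (λ T′ → setRow T′ d′ (rowOf T d′)) (setRow-rowOf T (suc d′) d≤) ⟩
  setRow T d′ (rowOf T d′)
    ≡⟨ setRow-rowOf T d′ (≤-trans (n≤1+n d′) d≤) ⟩
  T ∎

rowPair-replaceRows : ∀ T d′ P → suc d′ ≤ length T → (d′ ≡ 0 → proj₁ P ≡ []) →
                      rowPair (replaceRows T d′ P) d′ ≡ P
rowPair-replaceRows T d′ (U , L) d≤ empty = cong₂ _,_
  (rowOf-setRow-≡ (setRow T (suc d′) L) d′ U
     (subst (d′ ≤_) (sym (length-setRow T (suc d′) L)) (≤-trans (n≤1+n d′) d≤)) empty)
  (trans (rowOf-setRow-≢ (setRow T (suc d′) L) d′ (suc d′) U (1+n≢n ∘ sym))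
         (rowOf-setRow-≡ T (suc d′) L d≤ λ ()))

rowOf-replaceRows : ∀ T d′ P k → suc (suc d′) ≤ k → rowOf (replaceRows T d′ P) k ≡ rowOf T k
rowOf-replaceRows T d′ (U , L) k d<k =
  trans (rowOf-setRow-≢ (setRow T (suc d′) L) d′ k U λ { refl → <-irrefl refl (≤-trans (n≤1+n _) d<k) })
        (rowOf-setRow-≢ T (suc d′) k L λ { refl → <-irrefl refl d<k })

countNonX-cong : ∀ T T′ s m → (∀ k → s ≤ k → rowOf T k ≡ rowOf T′ k) →
                 countNonX T s m ≡ countNonX T′ s m
countNonX-cong T T′ s zero    _  = refl
countNonX-cong T T′ s (suc m) eq =
  cong₂ (λ r c → (if allX r then 0 else 1) + c) (eq s ≤-refl)
        (countNonX-cong T T′ (suc s) m λ k s<k → eq k (≤-trans (n≤1+n s) s<k))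

rankOf-replaceRows : ∀ n T d′ P → rankOf n (replaceRows T d′ P) (suc d′) ≡ rankOf n T (suc d′)
rankOf-replaceRows n T d′ P =
  cong suc (countNonX-cong _ T (suc (suc d′)) (n ∸ 1 ∸ suc d′) (rowOf-replaceRows T d′ P))

-- raise n (suc d′) and lower n (suc d′) are, definitionally,
-- exchangeRows raising n d′ and exchangeRows lowering n d′.
exchangeRows : (ℕ → ExchangeRule) → ℕ → ℕ → Triangle → Triangle
exchangeRows rule n d′ T = replaceRows T d′ (exchange (rule (rankOf n T (suc d′))) (rowPair T d′))

exchangeRows-undone : ∀ (E F : ℕ → ExchangeRule) n d′ T → suc d′ ≤ length T →
  let t = rankOf n T (suc d′) in
  exchange (F t) (exchange (E t) (rowPair T d′)) ≡ rowPair T d′ →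
  exchangeRows F n d′ (exchangeRows E n d′ T) ≡ T
exchangeRows-undone E F n d′ T d≤ undone = begin
  replaceRows T′ d′ (exchange (F (rankOf n T′ (suc d′))) (rowPair T′ d′))
    ≡⟨ cong₂ (λ t P → replaceRows T′ d′ (exchange (F t) P))
             (rankOf-replaceRows n T d′ P) (rowPair-replaceRows T d′ P d≤ λ { refl → refl }) ⟩
  replaceRows T′ d′ (exchange (F t) P)
    ≡⟨ cong (replaceRows T′ d′) undone ⟩
  replaceRows T′ d′ (rowPair T d′)
    ≡⟨ replaceRows-replaceRows T d′ P (rowPair T d′) ⟩
  replaceRows T d′ (rowPair T d′)
    ≡⟨ replaceRows-rowPair T d′ d≤ ⟩
  T ∎
  where
  t  = rankOf n T (suc d′)
  P  = exchange (E t) (rowPair T d′)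
  T′ = replaceRows T d′ P

-- Ranks

allX-true : ∀ {R} → XRow R → allX R ≡ true
allX-true []           = refl
allX-true (inx _ ∷ xs) = allX-true xs
allX-true (iny _ ∷ xs) = allX-true xs

allX-false : ∀ {k R} → All (InV k) R → R ≢ [] → allX R ≡ false
allX-false []          nonempty = contradiction refl nonempty
allX-false (ina _ ∷ _) _        = refl
allX-false (inb _ ∷ _) _        = refl

X∩V-empty : ∀ {k R} → XRow R → All (InV k) R → R ≡ []
X∩V-empty []          []       = refl
X∩V-empty (inx _ ∷ _) (() ∷ _)
X∩V-empty (iny _ ∷ _) (() ∷ _)

module Ranked {n T ρ} (isT : IsTriangle n T) (ranked : IsRanking n T ρ) where
  private
    step = proj₂ (proj₂ ranked)

  length-rowOf : ∀ r → r ≤ n → length (rowOf T r) ≡ r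
  length-rowOf zero    _   = refl
  length-rowOf (suc r) r<n = proj₁ (proj₂ isT) (suc r) (s≤s z≤n) r<n

  rowOf-nonempty : ∀ r → suc r ≤ n ∸ 1 → rowOf T (suc r) ≢ []
  rowOf-nonempty r r<n empty =
    contradiction (trans (sym (cong length empty)) (length-rowOf (suc r) (≤-trans r<n (m∸n≤m n 1)))) λ ()

  XRow-rank : ∀ r → suc r ≤ n ∸ 1 → XRow (rowOf T (suc r)) → ρ r ≡ ρ (suc r)
  XRow-rank r r<n xr with step (suc r) (s≤s z≤n) r<n
  ... | inj₁ (_ , eq)  = eq
  ... | inj₂ (vr , _) = contradiction (X∩V-empty xr vr) (rowOf-nonempty r r<n)

  VRow-rank : ∀ r → suc r ≤ n ∸ 1 → VRow (rowOf T (suc r)) →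
              All (InV (ρ (suc r))) (rowOf T (suc r)) × ρ r ≡ suc (ρ (suc r))
  VRow-rank r r<n (_ , vr) with step (suc r) (s≤s z≤n) r<n
  ... | inj₁ (xr , _) = contradiction (X∩V-empty xr vr) (rowOf-nonempty r r<n)
  ... | inj₂ ranked-V = ranked-V

  VRow-entries : ∀ r → r ≤ n ∸ 1 → VRow (rowOf T r) → All (InV (ρ r)) (rowOf T r)
  VRow-entries zero    _   _  = []
  VRow-entries (suc r) r<n vr = proj₁ (VRow-rank r r<n vr)

  ρ≡rankOf : ∀ r → r ≤ n ∸ 1 → ρ r ≡ rankOf n T r
  ρ≡rankOf r r≤n = counted (n ∸ 1 ∸ r) r (m+[n∸m]≡n r≤n)
    where
    r<n : ∀ m r → r + suc m ≡ n ∸ 1 → suc r ≤ n ∸ 1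
    r<n m r eq = ≤-trans (s≤s (m≤m+n r m)) (≤-reflexive (trans (sym (+-suc r m)) eq))

    counted : ∀ m r → r + m ≡ n ∸ 1 → ρ r ≡ suc (countNonX T (suc r) m)
    counted zero    r eq = trans (cong ρ (trans (sym (+-identityʳ r)) eq)) (proj₁ (proj₂ ranked))
    counted (suc m) r eq with step (suc r) (s≤s z≤n) (r<n m r eq)
    ... | inj₁ (xr , eq′) rewrite allX-true xr =
      trans eq′ (counted m (suc r) (trans (sym (+-suc r m)) eq))
    ... | inj₂ (vr , eq′) rewrite allX-false vr (rowOf-nonempty r (r<n m r eq)) =
      trans eq′ (cong suc (counted m (suc r) (trans (sym (+-suc r m)) eq)))

-- Admissible triangles

i-j+j≡i : ∀ i j → i ℤ.- j ℤ.+ j ≡ i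
i-j+j≡i i j = trans (ℤP.+-assoc i (ℤ.- j) j) (trans (cong (ℤ._+_ i) (ℤP.+-inverseˡ j)) (ℤP.+-identityʳ i))

j≤m-s⇒j+s≤m : ∀ {j m s} → + j ℤ.≤ + m ℤ.- + s → j + s ≤ m
j≤m-s⇒j+s≤m {j} {m} {s} le =
  ℤP.drop‿+≤+ (subst (+ (j + s) ℤ.≤_) (i-j+j≡i (+ m) (+ s)) (ℤP.+-monoˡ-≤ (+ s) le))

m-s<j⇒m<j+s : ∀ {m s j} → + m ℤ.- + s ℤ.< + j → m < j + s
m-s<j⇒m<j+s {m} {s} {j} lt =
  ℤP.drop‿+<+ (subst (ℤ._< + (j + s)) (i-j+j≡i (+ m) (+ s)) (ℤP.+-monoˡ-< (+ s) lt))

m<j+t⇒j≢m∸t : ∀ {m j t} → m < j + t → 1 ≤ j → j ≢ m ∸ t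
m<j+t⇒j≢m∸t {m} {j} {t} m<j+t 1≤j j≡m∸t with ≤-total t m
... | inj₁ t≤m = <-irrefl refl (subst (m <_) (trans (cong (_+ t) j≡m∸t) (m∸n+n≡m t≤m)) m<j+t)
... | inj₂ m≤t with () ← subst (1 ≤_) (trans j≡m∸t (m≤n⇒m∸n≡0 m≤t)) 1≤j

j+1+t≤m⇒m∸t≢j : ∀ {j t m} → j + suc t ≤ m → m ∸ t ≢ j
j+1+t≤m⇒m∸t≢j {j} {t} {m} le m∸t≡j = <-irrefl refl (subst₂ _≤_ (+-suc j t) m≡j+t le)
  where
  t≤m   = ≤-trans (≤-trans (n≤1+n t) (m≤n+m (suc t) j)) le
  m≡j+t = trans (sym (m∸n+n≡m t≤m)) (cong (_+ t) m∸t≡j)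

module AdjacentRows {n T ρ} (isT : IsTriangle n T) (ranked : IsRanking n T ρ)
                    (diagonal : MonotoneDiagonal n T ρ) (d′ : ℕ) (d≤ : suc d′ ≤ n ∸ 1) where
  open Ranked isT ranked

  R = rowOf T d′
  S = rowOf T (suc d′)
  t = rankOf n T (suc d′)

  private
    d≤n : suc d′ ≤ n
    d≤n = ≤-trans d≤ (m∸n≤m n 1)

    ρS : ρ (suc d′) ≡ t
    ρS = ρ≡rankOf (suc d′) d≤

    R-index : ∀ i {v} → lk R i ≡ just v → suc i ≤ d′
    R-index i eR = subst (i <_) (length-rowOf d′ (≤-trans (n≤1+n d′) d≤n)) (lk-length R i eR)

    S-entry : ∀ i → i ≤ d′ → ∃ λ u → lk S i ≡ just u
    S-entry i i≤d = lk-just S i (subst (i <_) (sym (length-rowOf (suc d′) d≤n)) (s≤s i≤d))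

    -- lk counts from 0, positions in a row from 1
    arrangement : ∀ i {u v w} → lk S i ≡ just u → lk R i ≡ just v → lk S (suc i) ≡ just w →
                  IsArrangementAt T n (suc d′) (suc i) u v w
    arrangement i eS eR eS⁺ =
      s≤s (≤-trans (s≤s z≤n) (R-index i eR)) , d≤n , s≤s z≤n , R-index i eR , eS , eR , eS⁺

    raising-separated-vertical : ∀ i {j m} → lk R i ≡ just (a j (j + t)) → lk S i ≡ just (y m) →
                                 j ≢ m ∸ t
    raising-separated-vertical i {j} {m} eR eS =
      m<j+t⇒j≢m∸t {m} {j} {t} (m-s<j⇒m<j+s (subst (λ k → + m ℤ.- + k ℤ.< + j) ρS y<a))
                  (proj₁ (All-lk valid i eR))
      where
      valid = proj₂ (proj₂ (proj₂ isT)) d′ (≤-trans (s≤s z≤n) (R-index i eR)) (≤-trans (n≤1+n d′) d≤)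
      y<a   = proj₁ (proj₂ (proj₂ (diagonal _ _ _ _ _
                (arrangement i eS eR (proj₂ (S-entry (suc i) (R-index i eR))))))) (isy m)

    raising-separated-diagonal : ∀ i {j m} → lk R i ≡ just (b j (j + t)) → lk S (suc i) ≡ just (x m) →
                                 j ≢ m
    raising-separated-diagonal i {j} {m} eR eS⁺ =
      <⇒≢ (+-cancelʳ-< t j m (ℤP.drop‿+<+ (subst (λ k → + (j + t) ℤ.< + (m + k)) ρS b<x)))
      where
      b<x = proj₂ (proj₂ (proj₂ (diagonal _ _ _ _ _
              (arrangement i (proj₂ (S-entry i (<⇒≤ (R-index i eR)))) eR eS⁺)))) (isx m)

    lowering-separated-vertical : ρ d′ ≡ suc t →
      ∀ i {j m} → lk R i ≡ just (y m) → lk S i ≡ just (a j (j + t)) → m ∸ t ≢ j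
    lowering-separated-vertical ρR i {j} {m} eR eS =
      j+1+t≤m⇒m∸t≢j {j} {t} {m} (j≤m-s⇒j+s≤m (subst (λ k → + j ℤ.≤ + m ℤ.- + k) ρR a≤y))
      where
      a≤y = proj₁ (diagonal _ _ _ _ _ (arrangement i eS eR (proj₂ (S-entry (suc i) (R-index i eR)))))

    lowering-separated-diagonal : ρ d′ ≡ suc t →
      ∀ i {j m} → lk R i ≡ just (x m) → lk S (suc i) ≡ just (b j (j + t)) → m ≢ j
    lowering-separated-diagonal ρR i {j} {m} eR eS⁺ =
      <⇒≢ (+-cancelʳ-< t m j (subst (_≤ j + t) (+-suc m t)
                                    (ℤP.drop‿+≤+ (subst (λ k → + (m + k) ℤ.≤ + (j + t)) ρR x≤b))))
      where
      x≤b = proj₁ (proj₂ (diagonal _ _ _ _ _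
              (arrangement i (proj₂ (S-entry i (<⇒≤ (R-index i eR)))) eR eS⁺)))

    d≤length : suc d′ ≤ length T
    d≤length = subst (suc d′ ≤_) (sym (proj₁ isT)) d≤n

  lower-raise : XRow S → VRow R → lower n (suc d′) (raise n (suc d′) T) ≡ T
  lower-raise xS vR = exchangeRows-undone raising lowering n d′ T d≤length
    (Undo.exchange-undone lowering-reverses-raising R S (All.map toV-toX vR′) (All.map toX-toV xS)
      (λ i → raising-fresh-vertical (lk-All vR′ i) (lk-All xS i) (raising-separated-vertical i))
      (λ i → raising-fresh-diagonal (lk-All vR′ i) (lk-All xS (suc i)) (raising-separated-diagonal i)))
    where
    vR′ : All (InV t) R
    vR′ = subst (λ k → All (InV k) R) (trans (XRow-rank d′ d≤ xS) ρS)
                (VRow-entries d′ (≤-trans (n≤1+n d′) d≤) vR)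

  raise-lower : VRow S → XRow R → raise n (suc d′) (lower n (suc d′) T) ≡ T
  raise-lower vS xR = exchangeRows-undone lowering raising n d′ T d≤length
    (Undo.exchange-undone raising-reverses-lowering R S (All.map toX-toV xR) (All.map toV-toX vS′)
      (λ i → lowering-fresh-vertical (lk-All xR i) (lk-All vS′ i) (lowering-separated-vertical ρR i))
      (λ i → lowering-fresh-diagonal (lk-All xR i) (lk-All vS′ (suc i)) (lowering-separated-diagonal ρR i)))
    where
    vS′ : All (InV t) S
    vS′ = subst (λ k → All (InV k) S) ρS (proj₁ (VRow-rank d′ d≤ vS))
    ρR : ρ d′ ≡ suc t
    ρR = trans (proj₂ (VRow-rank d′ d≤ vS)) (cong suc ρS)

lemma6 : (n d : ℕ) (T : Triangle) → Admissible n T → 1 ≤ d → d ≤ n ∸ 1 →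
    ((XRow (rowOf T d) → VRow (rowOf T (d ∸ 1)) → lower n d (raise n d T) ≡ T)
     × (VRow (rowOf T d) → XRow (rowOf T (d ∸ 1)) → raise n d (lower n d T) ≡ T))
lemma6 n (suc d′) T (isT , _ , ranked , diagonal , _) _ d≤ = lower-raise , raise-lower
  where open AdjacentRows isT ranked diagonal d′ d≤
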